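{- Let $X$ be one of the $27$ valid multinumbers listed in the context and $\vec f_X\in\Lambda^{4}$ its associated vector. Then the projection $\pi_0(\vec f_X)\in\mathbb{R}^2$ of $\vec f_X$ to the $0$-th factor has nonnegative first coordinate, and its first coordinate is strictly positive unless $X=0$, $X=3(2(10))$, or $X$ contains no digit $0$.
   Context: Realize $\Lambda\subset\mathbb{R}^2$ as the lattice spanned by $f=(0,1)$ and $\tau f$, where $\tau$ is counterclockwise rotation by $120^\circ$ (so $f+\tau f+\tau^2f=0$). Let $\Lambda^{4}=\Lambda^{1+3}$ have factors indexed $0,1,2,3$, with $f_i$ the vector $f$ in factor $i$, $\tau$ acting diagonally, and $\pi_0$ the projection to factor $0$. A multinumber is a digit in $\{0,1,2,3\}$ or a concatenation $YX$ of two multinumbers (parentheses indicate the grouping, e.g. $3(2(10))$ means $Y=3$, $X=2(10)$). Define $\vec f_i=f_i$ and recursively $\vec f_{YX}=-\tau\vec f_X-\tau^2\vec f_Y$. The valid multinumbers are: $0,1,2,3,10,20,21,30,31,32,2(10),(21)0,3(10),3(20),3(21),(31)0,(32)0,(32)1,3(2(10)),3((21)0),(3(21))0,((32)1)0,(32)(10),(3(21))(10),(32)((21)0),(3(2(10)))0,3(((32)1)0)$. -}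

module Defs where

open import Data.Integer using (ℤ; +_; -_; _+_; _-_; _≤_; _<_)
open import Data.Fin using (Fin; zero; suc; _≟_)
open import Data.List using (List; []; _∷_)
open import Data.Bool using (Bool; true; false; _∨_)
open import Relation.Nullary using (does)

-- An element  a·f + b·(τf)  of Λ ⊂ ℝ², with f = (0,1), τ = rotation by 120°.
record Λ : Set where
  constructor _f+_τf
  field
    a : ℤ
    b : ℤ
open Λ public

Λ0 : Λ
Λ0 = (+ 0) f+ (+ 0) τf

fΛ : Λ
fΛ = (+ 1) f+ (+ 0) τf

_⊕_ : Λ → Λ → Λ
(a₁ f+ b₁ τf) ⊕ (a₂ f+ b₂ τf) = (a₁ + a₂) f+ (b₁ + b₂) τf

⊖_ : Λ → Λ
⊖ (a₁ f+ b₁ τf) = (- a₁) f+ (- b₁) τf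

-- τ(a f + b τf) = a τf + b τ²f = a τf + b(-f - τf)   (using f + τf + τ²f = 0)
τΛ : Λ → Λ
τΛ (a₁ f+ b₁ τf) = (- b₁) f+ (a₁ - b₁) τf

-- The first (x-)coordinate in ℝ² of  a f + b τf  equals  (√3/2)·(-b),
-- since f = (0,1) and τf = (-√3/2, -1/2).  We record the integer  -b,
-- i.e. the first coordinate divided by the positive constant √3/2;
-- signs (≥ 0, > 0) are therefore preserved exactly.
firstCoord/[√3/2] : Λ → ℤ
firstCoord/[√3/2] v = - b v

-- Λ^{1+3} = Λ⁴, factors indexed by Fin 4.
Λ⁴ : Set
Λ⁴ = Fin 4 → Λ

_⊕⁴_ : Λ⁴ → Λ⁴ → Λ⁴
(v ⊕⁴ w) i = v i ⊕ w i

⊖⁴_ : Λ⁴ → Λ⁴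
(⊖⁴ v) i = ⊖ v i

τ⁴ : Λ⁴ → Λ⁴
τ⁴ v i = τΛ (v i)

f⁴ : Fin 4 → Λ⁴
f⁴ i j with does (i ≟ j)
... | true  = fΛ
... | false = Λ0

π₀ : Λ⁴ → Λ
π₀ v = v zero

-- Multinumbers: a digit, or a concatenation YX (written  cat Y X).
data Multinumber : Set where
  dig : Fin 4 → Multinumber
  cat : Multinumber → Multinumber → Multinumber

vecF : Multinumber → Λ⁴
vecF (dig i)   = f⁴ i
vecF (cat Y X) = (⊖⁴ τ⁴ (vecF X)) ⊕⁴ (⊖⁴ τ⁴ (τ⁴ (vecF Y)))

containsZero : Multinumber → Bool
containsZero (dig zero)    = true
containsZero (dig (suc _)) = false
containsZero (cat Y X)     = containsZero Y ∨ containsZero X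

m0 m1 m2 m3 : Multinumber
m0 = dig zero
m1 = dig (suc zero)
m2 = dig (suc (suc zero))
m3 = dig (suc (suc (suc zero)))

m3[2[10]] : Multinumber
m3[2[10]] = cat m3 (cat m2 (cat m1 m0))

validMultinumbers : List Multinumber
validMultinumbers =
    m0 ∷ m1 ∷ m2 ∷ m3
  ∷ cat m1 m0 ∷ cat m2 m0 ∷ cat m2 m1 ∷ cat m3 m0 ∷ cat m3 m1 ∷ cat m3 m2
  ∷ cat m2 (cat m1 m0)
  ∷ cat (cat m2 m1) m0
  ∷ cat m3 (cat m1 m0)
  ∷ cat m3 (cat m2 m0)
  ∷ cat m3 (cat m2 m1)
  ∷ cat (cat m3 m1) m0
  ∷ cat (cat m3 m2) m0
  ∷ cat (cat m3 m2) m1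
  ∷ m3[2[10]]
  ∷ cat m3 (cat (cat m2 m1) m0)
  ∷ cat (cat m3 (cat m2 m1)) m0
  ∷ cat (cat (cat m3 m2) m1) m0
  ∷ cat (cat m3 m2) (cat m1 m0)
  ∷ cat (cat m3 (cat m2 m1)) (cat m1 m0)
  ∷ cat (cat m3 m2) (cat (cat m2 m1) m0)
  ∷ cat (cat m3 (cat m2 (cat m1 m0))) m0
  ∷ cat m3 (cat (cat (cat m3 m2) m1) m0)
  ∷ []

-- The first coordinate of π₀ f⃗_X only sees the digits 0 of X, since the recursion for f⃗ is
-- linear and acts factorwise; in particular it vanishes when X has no digit 0.  For the
-- remaining valid multinumbers the sign is read off by evaluating the integer coordinates.
module Submission where

open import Defs
open import Data.Integer using (ℤ; +_; _≤_; _<_; _<?_)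
open import Data.Integer.Properties using (≤-refl; <⇒≤)
import Data.Bool as Bool
open import Data.Bool using (true; false; _∨_)
open import Data.Fin using (suc)
import Data.Fin as Fin
open import Data.Product using (_×_; _,_)
open import Data.Sum using (_⊎_; inj₁; inj₂)
open import Data.List.Membership.Propositional using (_∈_)
open import Data.List.Relation.Unary.All as All using (All; all?)
open import Relation.Binary.Definitions using (DecidableEquality)
open import Relation.Binary.PropositionalEquality using (_≡_; refl; sym; trans; cong; cong₂)
open import Relation.Nullary using (¬_; Dec; no; contradiction)
open import Relation.Nullary.Decidable using (_⊎-dec_; map′; _×-dec_; from-yes)

∨-≡-false : ∀ {a b} → a ∨ b ≡ false → (a ≡ false) × (b ≡ false)
∨-≡-false {false} b≡false = refl , b≡false

π₀-vecF-zeroFree : ∀ X → containsZero X ≡ false → π₀ (vecF X) ≡ Λ0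
π₀-vecF-zeroFree (dig (suc i)) _ = refl
π₀-vecF-zeroFree (cat Y X) noZero with ∨-≡-false {containsZero Y} noZero
... | Y-noZero , X-noZero
  rewrite π₀-vecF-zeroFree Y Y-noZero | π₀-vecF-zeroFree X X-noZero = refl

x-coord : Multinumber → ℤ
x-coord X = firstCoord/[√3/2] (π₀ (vecF X))

Positive : Multinumber → Set
Positive X = + 0 < x-coord X

cat-injective : ∀ {Y Y′ X X′} → cat Y X ≡ cat Y′ X′ → (Y ≡ Y′) × (X ≡ X′)
cat-injective refl = refl , refl

_≟_ : DecidableEquality Multinumber
dig i ≟ dig j   = map′ (cong dig) (λ { refl → refl }) (i Fin.≟ j)
cat Y X ≟ cat Y′ X′ =
  map′ (λ (Y≡ , X≡) → cong₂ cat Y≡ X≡) cat-injective ((Y ≟ Y′) ×-dec (X ≟ X′))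
dig _ ≟ cat _ _ = no λ ()
cat _ _ ≟ dig _ = no λ ()

ZeroFreeOrExceptionalOrPositive : Multinumber → Set
ZeroFreeOrExceptionalOrPositive X =
  containsZero X ≡ false ⊎ X ≡ m0 ⊎ X ≡ m3[2[10]] ⊎ Positive X

zeroFreeOrExceptionalOrPositive? : ∀ X → Dec (ZeroFreeOrExceptionalOrPositive X)
zeroFreeOrExceptionalOrPositive? X =
  (containsZero X Bool.≟ false) ⊎-dec (X ≟ m0) ⊎-dec (X ≟ m3[2[10]]) ⊎-dec (+ 0 <? x-coord X)

valid⇒zeroFreeOrExceptionalOrPositive : All ZeroFreeOrExceptionalOrPositive validMultinumbers
valid⇒zeroFreeOrExceptionalOrPositive = from-yes (all? zeroFreeOrExceptionalOrPositive? validMultinumbers)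

zeroFreeOrExceptionalOrPositive⇒nonneg : ∀ X → ZeroFreeOrExceptionalOrPositive X → + 0 ≤ x-coord X
zeroFreeOrExceptionalOrPositive⇒nonneg X (inj₁ noZero) rewrite π₀-vecF-zeroFree X noZero = ≤-refl
zeroFreeOrExceptionalOrPositive⇒nonneg _ (inj₂ (inj₁ refl)) = ≤-refl
zeroFreeOrExceptionalOrPositive⇒nonneg _ (inj₂ (inj₂ (inj₁ refl))) = ≤-refl
zeroFreeOrExceptionalOrPositive⇒nonneg _ (inj₂ (inj₂ (inj₂ pos))) = <⇒≤ pos

lemma12 : ∀ (X : Multinumber) → X ∈ validMultinumbers →
    (+ 0 ≤ firstCoord/[√3/2] (π₀ (vecF X)))
    × (¬ (X ≡ m0) → ¬ (X ≡ m3[2[10]]) → containsZero X ≡ true →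
    + 0 < firstCoord/[√3/2] (π₀ (vecF X)))
lemma12 X X∈valid = zeroFreeOrExceptionalOrPositive⇒nonneg X cases , positive cases
  where
  cases : ZeroFreeOrExceptionalOrPositive X
  cases = All.lookup valid⇒zeroFreeOrExceptionalOrPositive X∈valid

  positive : ZeroFreeOrExceptionalOrPositive X →
    ¬ (X ≡ m0) → ¬ (X ≡ m3[2[10]]) → containsZero X ≡ true → Positive X
  positive (inj₁ noZero)               _ _ hasZero = contradiction (trans (sym noZero) hasZero) λ ()
  positive (inj₂ (inj₁ X≡0))           X≢0 _ _ = contradiction X≡0 X≢0
  positive (inj₂ (inj₂ (inj₁ X≡exc)))  _ X≢exc _ = contradiction X≡exc X≢exc
  positive (inj₂ (inj₂ (inj₂ pos)))    _ _ _ = pos
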